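{- A code $C\subseteq \{0,1\}^3$ in the binary $3$-dimensional hypercube is an identifying code if and only if it is a local identifying code. Consequently, $M^L(3)=M(3)=4$, where $M^L(3)$ and $M(3)$ denote the minimum cardinalities of a local identifying code and of an identifying code, respectively, in the binary $3$-dimensional hypercube.
   Context: The binary $n$-dimensional hypercube is the graph with vertex set $\{0,1\}^n$ in which two binary words are adjacent iff their Hamming distance is $1$. For a vertex $u$, $N[u]$ is its closed neighbourhood, and for a code (nonempty vertex subset) $C$, $I_C(u)=N[u]\cap C$. A code $C$ is a covering code if $I_C(u)\neq\emptyset$ for every vertex $u$. $C$ is an identifying code if it is a covering code and $I_C(u)\neq I_C(v)$ for all distinct vertices $u,v$; $C$ is a local identifying code if it is a covering code and $I_C(u)\neq I_C(v)$ for every pair of adjacent vertices $u,v$. -}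

module Defs where

open import Data.Bool using (Bool; true; false; _∧_; _xor_; if_then_else_)
open import Data.Nat using (ℕ; zero; suc; _+_; _≤_)
open import Data.Vec using (Vec; []; _∷_; zipWith; count)
open import Data.List using (List; []; _∷_; map; _++_; length; filter)
open import Data.Product using (Σ; _×_; _,_; ∃)
open import Relation.Binary.PropositionalEquality using (_≡_)
open import Relation.Nullary using (¬_)
open import Data.Bool.Properties using (T?)

Word : ℕ → Set
Word n = Vec Bool n

hamming : ∀ {n} → Word n → Word n → ℕ
hamming [] [] = 0
hamming (x ∷ xs) (y ∷ ys) = (if x xor y then 1 else 0) + hamming xs ys

allWords : (n : ℕ) → List (Word n)
allWords zero = [] ∷ []
allWords (suc n) = map (false ∷_) (allWords n) ++ map (true ∷_) (allWords n)

Adjacent : ∀ {n} → Word n → Word n → Set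
Adjacent u v = hamming u v ≡ 1

InClosedNbhd : ∀ {n} → Word n → Word n → Set
InClosedNbhd u w = hamming u w ≤ 1

Code : ℕ → Set
Code n = Word n → Bool

_∈C_ : ∀ {n} → Word n → Code n → Set
w ∈C C = C w ≡ true

card : ∀ {n} → Code n → ℕ
card {n} C = length (filter (λ w → T? (C w)) (allWords n))

Nonempty : ∀ {n} → Code n → Set
Nonempty {n} C = ∃ λ (w : Word n) → w ∈C C

I : ∀ {n} → Code n → Word n → Word n → Set
I C u w = InClosedNbhd u w × w ∈C C

SameI : ∀ {n} → Code n → Word n → Word n → Set
SameI {n} C u v = (w : Word n) → (I C u w → I C v w) × (I C v w → I C u w)

IsCovering : ∀ {n} → Code n → Set
IsCovering {n} C = (u : Word n) → ∃ λ (w : Word n) → I C u w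

IsIdentifying : ∀ {n} → Code n → Set
IsIdentifying {n} C =
  Nonempty C × IsCovering C × ((u v : Word n) → ¬ (u ≡ v) → ¬ SameI C u v)

IsLocalIdentifying : ∀ {n} → Code n → Set
IsLocalIdentifying {n} C =
  Nonempty C × IsCovering C × ((u v : Word n) → Adjacent u v → ¬ SameI C u v)

IsMinCard : ∀ {n} → (Code n → Set) → ℕ → Set
IsMinCard {n} P m =
  (Σ (Code n) λ C → P C × card C ≡ m) × ((C : Code n) → P C → m ≤ card C)

-- Every notion involved is decidable and invariant under pointwise equality of
-- codes, and Q_3 has only 2^8 codes, so "local identifying ⇒ identifying" and
-- the bound |C| ≥ 4 are checked over all of them (the bound also follows from
-- the fact that the 8 sets I_C(u) are distinct and nonempty, so 2^|C| − 1 ≥ 8).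
-- "Identifying ⇒ local identifying" holds in every dimension, since adjacent
-- words are distinct, and the even-weight code {000, 011, 101, 110} attains 4.
module Submission where

open import Defs
open import Data.Bool using (Bool; true; false; T; not; _xor_)
open import Data.Bool.Properties using (T?; xor-same) renaming (_≟_ to _≟ᵇ_)
open import Data.List using (length; filter)
open import Data.List.Properties using (filter-≐)
open import Data.Nat using (ℕ; zero; suc; _≤_; _≟_; _≤?_)
open import Data.Product using (_×_; _,_; proj₁; proj₂; ∃)
open import Data.Sum using (inj₁; inj₂)
open import Data.Vec using ([]; _∷_; foldr)
open import Data.Vec.Properties using (≡-dec)
open import Function using (_∘_)
open import Function.Bundles using (_⇔_; mk⇔)
open import Relation.Binary.PropositionalEquality
  using (_≡_; _≢_; refl; sym; trans; cong; subst; _≗_)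
open import Relation.Nullary using (Dec)
open import Relation.Nullary.Decidable
  using (map′; _×-dec_; _⊎-dec_; _→-dec_; ¬?; toWitness)

private
  variable
    n : ℕ

all? : {P : Word n → Set} → ((w : Word n) → Dec (P w)) → Dec ((w : Word n) → P w)
all? {zero}  P? = map′ (λ p → λ { [] → p }) (λ f → f []) (P? [])
all? {suc n} P? =
  map′ (λ (f , t) → λ { (false ∷ w) → f w ; (true ∷ w) → t w })
       (λ g → g ∘ (false ∷_) , g ∘ (true ∷_))
       (all? (P? ∘ (false ∷_)) ×-dec all? (P? ∘ (true ∷_)))

any? : {P : Word n → Set} → ((w : Word n) → Dec (P w)) → Dec (∃ P)
any? {zero}  P? = map′ ([] ,_) (λ { ([] , p) → p }) (P? [])
any? {suc n} P? =
  map′ (λ { (inj₁ (w , p)) → false ∷ w , p ; (inj₂ (w , p)) → true ∷ w , p })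
       (λ { (false ∷ w , p) → inj₁ (w , p) ; (true ∷ w , p) → inj₂ (w , p) })
       (any? (P? ∘ (false ∷_)) ⊎-dec any? (P? ∘ (true ∷_)))

module _ (C : Code n) where

  ∈C? : (w : Word n) → Dec (w ∈C C)
  ∈C? w = C w ≟ᵇ true

  I? : (u w : Word n) → Dec (I C u w)
  I? u w = (hamming u w ≤? 1) ×-dec ∈C? w

  SameI? : (u v : Word n) → Dec (SameI C u v)
  SameI? u v = all? λ w → (I? u w →-dec I? v w) ×-dec (I? v w →-dec I? u w)

  nonempty? : Dec (Nonempty C)
  nonempty? = any? ∈C?

  isCovering? : Dec (IsCovering C)
  isCovering? = all? (any? ∘ I?)

  isIdentifying? : Dec (IsIdentifying C)
  isIdentifying? = nonempty? ×-dec isCovering? ×-dec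
    all? λ u → all? λ v → ¬? (≡-dec _≟ᵇ_ u v) →-dec ¬? (SameI? u v)

  isLocalIdentifying? : Dec (IsLocalIdentifying C)
  isLocalIdentifying? = nonempty? ×-dec isCovering? ×-dec
    all? λ u → all? λ v → (hamming u v ≟ 1) →-dec ¬? (SameI? u v)

Extensional : (Code n → Set) → Set
Extensional P = ∀ {C D} → C ≗ D → P C → P D

∈C-resp : ∀ {C D : Code n} → C ≗ D → ∀ w → w ∈C C → w ∈C D
∈C-resp C≗D w w∈C = trans (sym (C≗D w)) w∈C

I-resp : ∀ {C D : Code n} → C ≗ D → ∀ u w → I C u w → I D u w
I-resp C≗D u w (d , w∈C) = d , ∈C-resp C≗D w w∈C

SameI-resp : ∀ {C D : Code n} → C ≗ D → ∀ u v → SameI D u v → SameI C u v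
SameI-resp C≗D u v s w = (I-resp D≗C v w ∘ proj₁ (s w) ∘ I-resp C≗D u w)
                       , (I-resp D≗C u w ∘ proj₂ (s w) ∘ I-resp C≗D v w)
  where D≗C = sym ∘ C≗D

nonempty-resp : Extensional (Nonempty {n})
nonempty-resp C≗D (w , w∈C) = w , ∈C-resp C≗D w w∈C

isCovering-resp : Extensional (IsCovering {n})
isCovering-resp C≗D cov u = let (w , i) = cov u in w , I-resp C≗D u w i

isIdentifying-resp : Extensional (IsIdentifying {n})
isIdentifying-resp C≗D (ne , cov , sep) =
  nonempty-resp C≗D ne , isCovering-resp C≗D cov ,
  λ u v u≢v → sep u v u≢v ∘ SameI-resp C≗D u v

isLocalIdentifying-resp : Extensional (IsLocalIdentifying {n})
isLocalIdentifying-resp C≗D (ne , cov , sep) =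
  nonempty-resp C≗D ne , isCovering-resp C≗D cov ,
  λ u v adj → sep u v adj ∘ SameI-resp C≗D u v

card-resp : ∀ {C D : Code n} → C ≗ D → card C ≡ card D
card-resp {C = C} {D} C≗D = cong length (filter-≐ (T? ∘ C) (T? ∘ D)
  ((λ {w} → subst T (C≗D w)) , (λ {w} → subst T (sym (C≗D w)))) (allWords _))

join : Code n → Code n → Code (suc n)
join g h (false ∷ w) = g w
join g h (true  ∷ w) = h w

join-cong : ∀ {g g′ h h′ : Code n} → g ≗ g′ → h ≗ h′ → join g h ≗ join g′ h′
join-cong g≗g′ h≗h′ (false ∷ w) = g≗g′ w
join-cong g≗g′ h≗h′ (true  ∷ w) = h≗h′ w

join-split : (C : Code (suc n)) → C ≗ join (C ∘ (false ∷_)) (C ∘ (true ∷_))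
join-split C (false ∷ w) = refl
join-split C (true  ∷ w) = refl

-- Codes are functions, so the enumeration below reaches each code only up to ≗;
-- this is why P must be extensional.
allCodes? : {P : Code n → Set} → Extensional P →
            ((C : Code n) → Dec (P C)) → Dec ((C : Code n) → P C)
allCodes? {zero} {P} resp P? =
  map′ (λ (f , t) C → resp (λ { [] → refl }) (constant (C []) f t))
       (λ all → all _ , all _)
       (P? (λ _ → false) ×-dec P? (λ _ → true))
  where
  constant : (b : Bool) → P (λ _ → false) → P (λ _ → true) → P (λ _ → b)
  constant false f t = f
  constant true  f t = t
allCodes? {suc n} {P} resp P? =
  map′ (λ all C → resp (sym ∘ join-split C) (all _ _))
       (λ all g h → all (join g h))
       (allCodes? (λ g≗g′ all h → resp (join-cong g≗g′ λ _ → refl) (all h)) λ g →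
        allCodes? (λ h≗h′ → resp (join-cong (λ _ → refl) h≗h′)) λ h →
        P? (join g h))

hamming-self : (u : Word n) → hamming u u ≡ 0
hamming-self []      = refl
hamming-self (x ∷ u) rewrite xor-same x = hamming-self u

adjacent⇒≢ : {u v : Word n} → Adjacent u v → u ≢ v
adjacent⇒≢ {u = u} adj refl with () ← trans (sym (hamming-self u)) adj

identifying⇒localIdentifying : {C : Code n} → IsIdentifying C → IsLocalIdentifying C
identifying⇒localIdentifying (ne , cov , sep) =
  ne , cov , λ u v adj → sep u v (adjacent⇒≢ adj)

evenWeight : Code n
evenWeight = not ∘ foldr _ _xor_ false

evenWeight-identifying : IsIdentifying {3} evenWeight
evenWeight-identifying = toWitness {a? = isIdentifying? evenWeight} _

localIdentifying⇒identifying×4≤card : (C : Code 3) → IsLocalIdentifying C →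
                                      IsIdentifying C × 4 ≤ card C
localIdentifying⇒identifying×4≤card = toWitness {a? = allCodes? resp λ C →
  isLocalIdentifying? C →-dec (isIdentifying? C ×-dec 4 ≤? card C)} _
  where
  resp : Extensional λ C → IsLocalIdentifying C → IsIdentifying C × 4 ≤ card C
  resp C≗D f loc =
    let (ident , large) = f (isLocalIdentifying-resp (sym ∘ C≗D) loc)
    in isIdentifying-resp C≗D ident , subst (4 ≤_) (card-resp C≗D) large

mainTheorem3 :
    ((C : Code 3) → IsIdentifying C ⇔ IsLocalIdentifying C)
      × IsMinCard {3} IsLocalIdentifying 4
      × IsMinCard {3} IsIdentifying 4
mainTheorem3 =
    (λ C → mk⇔ identifying⇒localIdentifying (proj₁ ∘ localIdentifying⇒identifying×4≤card C))
  , ((evenWeight , identifying⇒localIdentifying evenWeight-identifying , refl)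
    , λ C → proj₂ ∘ localIdentifying⇒identifying×4≤card C)
  , ((evenWeight , evenWeight-identifying , refl)
    , λ C → proj₂ ∘ localIdentifying⇒identifying×4≤card C ∘ identifying⇒localIdentifying)
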